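{- Let $\Gamma=\Gamma(\mathbb{Z}_n,S)$ be a circulant digraph of order $n$ and let $K\le H$ be subgroups of $\mathbb{Z}_n$ with $K\ne\{0\}$ and $H\ne\mathbb{Z}_n$. Let $\mathcal{B}$ and $\mathcal{C}$ be the partitions of $\mathbb{Z}_n$ into cosets of $K$ and of $H$, respectively (so $\mathcal{B}\preceq\mathcal{C}$). Then $\Gamma$ is a $(K,H)$-generalized wreath circulant digraph if and only if there exists $G\le{\rm Aut}(\Gamma)$ containing a regular cyclic subgroup, having $\mathcal{B}$ and $\mathcal{C}$ as complete block systems, such that ${\rm fix}_{G^{(2)}}(\mathcal{B})|_C\le G^{(2)}$ for every $C\in\mathcal{C}$.
   Context: $\Gamma(\mathbb{Z}_n,S)$ has vertex set $\mathbb{Z}_n$ and arc set $\{(u,v):u-v\in S\}$, $S\subseteq\mathbb{Z}_n\setminus\{0\}$. It is a $(K,H)$-generalized wreath circulant digraph if $S\setminus H$ is a union of cosets of $K$. $G^{(2)}$ is the 2-closure of $G$ (the largest subgroup of ${\rm Sym}(\mathbb{Z}_n)$ with the same orbits on $\mathbb{Z}_n\times\mathbb{Z}_n$ as $G$). For a complete block system $\mathcal{B}$, ${\rm fix}_G(\mathcal{B})$ is the subgroup of elements fixing every block setwise; $\mathcal{B}\preceq\mathcal{C}$ means each block of $\mathcal{C}$ is a union of blocks of $\mathcal{B}$; for $g\in{\rm fix}(\mathcal{B})$ and $C\in\mathcal{C}$, $g|_C$ agrees with $g$ on $C$ and fixes all points outside $C$. -}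

module Defs where

open import Data.Nat using (ℕ; zero; suc; _+_; _∸_; NonZero)
open import Data.Nat.DivMod using (_mod_)
open import Data.Fin using (Fin; toℕ)
open import Data.Fin.Subset using (Subset; _∈_; _∉_; _⊆_)
open import Data.Fin.Subset.Properties using (_∈?_)
open import Data.Bool using (if_then_else_)
open import Data.Product using (Σ; ∃; _×_; _,_)
open import Relation.Nullary using (¬_; does)
open import Relation.Binary.PropositionalEquality using (_≡_; _≢_)
open import Function.Bundles using (_⇔_)

module _ {n : ℕ} .{{_ : NonZero n}} where

  0ₙ : Fin n
  0ₙ = 0 mod n

  infixl 6 _+ₙ_ _-ₙ_
  _+ₙ_ : Fin n → Fin n → Fin n
  x +ₙ y = (toℕ x + toℕ y) mod n

  _-ₙ_ : Fin n → Fin n → Fin n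
  x -ₙ y = (toℕ x + (n ∸ toℕ y)) mod n

IsSubgroupℤ : {n : ℕ} .{{_ : NonZero n}} → Subset n → Set
IsSubgroupℤ {n} K = (0ₙ ∈ K) × (∀ x y → x ∈ K → y ∈ K → (x -ₙ y) ∈ K)

Arc : {n : ℕ} .{{_ : NonZero n}} → Subset n → Fin n → Fin n → Set
Arc S u v = (u -ₙ v) ∈ S

-- (K,H)-generalized wreath: S ∖ H is a union of cosets of K.
GenWreath : {n : ℕ} .{{_ : NonZero n}} → (S K H : Subset n) → Set
GenWreath S K H = ∀ s k → s ∈ S → s ∉ H → k ∈ K → (s +ₙ k) ∈ S

Fun : ℕ → Set
Fun n = Fin n → Fin n

IsBij : {n : ℕ} → Fun n → Set
IsBij f = (∀ x y → f x ≡ f y → x ≡ y) × (∀ y → ∃ λ x → f x ≡ y)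

idF : {n : ℕ} → Fun n
idF x = x

iter : {n : ℕ} → Fun n → ℕ → Fun n
iter f zero x = x
iter f (suc k) x = f (iter f k x)

_≗_ : {n : ℕ} → Fun n → Fun n → Set
f ≗ g = ∀ x → f x ≡ g x

IsPermGroup : {n : ℕ} → (Fun n → Set) → Set
IsPermGroup G =
  (∀ f g → f ≗ g → G f → G g)
  × (∀ f → G f → IsBij f)
  × G idF
  × (∀ f g → G f → G g → G (λ x → f (g x)))
  × (∀ f → G f → ∃ λ h → G h × (∀ x → h (f x) ≡ x) × (∀ x → f (h x) ≡ x))

IsAut : {n : ℕ} .{{_ : NonZero n}} → Subset n → Fun n → Set
IsAut S f = IsBij f × (∀ u v → Arc S u v ⇔ Arc S (f u) (f v))

IsCyclic : {n : ℕ} → (Fun n → Set) → Set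
IsCyclic R = ∃ λ σ → R σ × (∀ f → R f → ∃ λ k → f ≗ iter σ k)

IsRegular : {n : ℕ} → (Fun n → Set) → Set
IsRegular R = (∀ x y → ∃ λ f → R f × f x ≡ y)
            × (∀ f x → R f → f x ≡ x → f ≗ idF)

HasRegularCyclicSubgroup : {n : ℕ} → (Fun n → Set) → Set₁
HasRegularCyclicSubgroup {n} G =
  Σ (Fun n → Set) λ R → IsPermGroup R × (∀ f → R f → G f) × IsCyclic R × IsRegular R

IsBlockSystemCosets : {n : ℕ} .{{_ : NonZero n}} → (Fun n → Set) → Subset n → Set
IsBlockSystemCosets G K = ∀ f → G f → ∀ x y → (x -ₙ y) ∈ K → (f x -ₙ f y) ∈ K

Closure2 : {n : ℕ} → (Fun n → Set) → Fun n → Set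
Closure2 G f = IsBij f × (∀ x y → ∃ λ h → G h × h x ≡ f x × h y ≡ f y)

Fix : {n : ℕ} .{{_ : NonZero n}} → (Fun n → Set) → Subset n → Fun n → Set
Fix G K f = G f × (∀ x → (f x -ₙ x) ∈ K)

restrict : {n : ℕ} .{{_ : NonZero n}} → Subset n → Fin n → Fun n → Fun n
restrict H c g x = if does ((x -ₙ c) ∈? H) then g x else x

-- For the forward direction take G to be the group of automorphisms of Γ that also preserve
-- the cosets of K and of H. Every relation involved is circulant, so G contains the
-- translations; G is the automorphism group of a binary relational structure, hence
-- 2-closed; and restricting an element of G that fixes the K-cosets to one H-coset C
-- changes the arcs between C and its complement only by K-shifts of differences lying
-- outside H, which S tolerates exactly because S ∖ H is a union of K-cosets.
-- Conversely, given s ∈ S ∖ H and k ∈ K, an element r of the regular cyclic subgroup with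
-- r s = s + k fixes every K-coset (the subgroup is abelian and transitive), so r|_(s+H)
-- lies in G^(2). An element of G agreeing with it on s and 0 carries the arc (s, 0) to
-- (s + k, 0), whence s + k ∈ S.
module Submission where

open import Defs
open import Data.Nat using (ℕ; NonZero; zero; suc; _+_; _∸_; _%_; >-nonZero⁻¹)
open import Data.Nat.Properties using (+-comm; +-assoc; +-identityʳ; m+[n∸m]≡n; m∸n+n≡m; <⇒≤)
open import Data.Nat.DivMod using (_mod_; %-distribˡ-+; m%n%n≡m%n; m<n⇒m%n≡m; [m+n]%n≡m%n)
open import Data.Fin using (Fin; toℕ)
open import Data.Fin.Properties using (toℕ-injective; toℕ-fromℕ<; toℕ<n)
open import Data.Fin.Subset using (Subset; _∈_; _∉_; _⊆_)
open import Data.Fin.Subset.Properties using (_∈?_)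
open import Data.Product using (Σ; ∃; _×_; _,_; proj₁; proj₂)
open import Data.Empty using (⊥-elim)
open import Relation.Nullary using (¬_; yes; no)
open import Relation.Binary.PropositionalEquality
  using (_≡_; _≢_; refl; sym; trans; cong; cong₂; subst; subst₂; module ≡-Reasoning)
open import Function.Bundles using (_⇔_; mk⇔; Equivalence)
open import Function.Construct.Identity using (⇔-id)
open import Function.Construct.Symmetry using (⇔-sym)
open import Function.Construct.Composition using (_⇔-∘_)

open Equivalence using (to; from)

module _ {n : ℕ} .{{_ : NonZero n}} where
  open ≡-Reasoning

  toℕ-mod : ∀ m → toℕ (m mod n) ≡ m % n
  toℕ-mod m = toℕ-fromℕ< _

  toℕ-0ₙ : toℕ (0ₙ {n}) ≡ 0
  toℕ-0ₙ = trans (toℕ-mod 0) (m<n⇒m%n≡m (>-nonZero⁻¹ n))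

  mod-toℕ : (x : Fin n) → toℕ x mod n ≡ x
  mod-toℕ x = toℕ-injective (trans (toℕ-mod _) (m<n⇒m%n≡m (toℕ<n x)))

  %-cong-mod : ∀ {a b} → a % n ≡ b % n → a mod n ≡ b mod n
  %-cong-mod {a} {b} eq = toℕ-injective (trans (toℕ-mod a) (trans eq (sym (toℕ-mod b))))

  [m%n+o]%n≡[m+o]%n : ∀ m o → (m % n + o) % n ≡ (m + o) % n
  [m%n+o]%n≡[m+o]%n m o = begin
    (m % n + o) % n          ≡⟨ %-distribˡ-+ (m % n) o n ⟩
    (m % n % n + o % n) % n  ≡⟨ cong (λ t → (t + o % n) % n) (m%n%n≡m%n m n) ⟩
    (m % n + o % n) % n      ≡⟨ %-distribˡ-+ m o n ⟨
    (m + o) % n              ∎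

  [m+o%n]%n≡[m+o]%n : ∀ m o → (m + o % n) % n ≡ (m + o) % n
  [m+o%n]%n≡[m+o]%n m o = begin
    (m + o % n) % n  ≡⟨ cong (_% n) (+-comm m (o % n)) ⟩
    (o % n + m) % n  ≡⟨ [m%n+o]%n≡[m+o]%n o m ⟩
    (o + m) % n      ≡⟨ cong (_% n) (+-comm o m) ⟩
    (m + o) % n      ∎

  [[m+a]%n+b]%n≡m%n : ∀ m a b → a + b ≡ n → ((m + a) % n + b) % n ≡ m % n
  [[m+a]%n+b]%n≡m%n m a b a+b≡n = begin
    ((m + a) % n + b) % n  ≡⟨ [m%n+o]%n≡[m+o]%n (m + a) b ⟩
    (m + a + b) % n        ≡⟨ cong (_% n) (+-assoc m a b) ⟩
    (m + (a + b)) % n      ≡⟨ cong (λ t → (m + t) % n) a+b≡n ⟩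
    (m + n) % n            ≡⟨ [m+n]%n≡m%n m n ⟩
    m % n                  ∎

  +ₙ-comm : (x y : Fin n) → x +ₙ y ≡ y +ₙ x
  +ₙ-comm x y = cong (_mod n) (+-comm (toℕ x) (toℕ y))

  +ₙ-assoc : (x y z : Fin n) → (x +ₙ y) +ₙ z ≡ x +ₙ (y +ₙ z)
  +ₙ-assoc x y z = %-cong-mod (begin
    (toℕ (x +ₙ y) + toℕ z) % n          ≡⟨ cong (λ t → (t + toℕ z) % n) (toℕ-mod _) ⟩
    ((toℕ x + toℕ y) % n + toℕ z) % n  ≡⟨ [m%n+o]%n≡[m+o]%n _ _ ⟩
    (toℕ x + toℕ y + toℕ z) % n        ≡⟨ cong (_% n) (+-assoc (toℕ x) _ _) ⟩
    (toℕ x + (toℕ y + toℕ z)) % n      ≡⟨ [m+o%n]%n≡[m+o]%n _ _ ⟨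
    (toℕ x + (toℕ y + toℕ z) % n) % n  ≡⟨ cong (λ t → (toℕ x + t) % n) (toℕ-mod _) ⟨
    (toℕ x + toℕ (y +ₙ z)) % n          ∎)

  +ₙ-identityʳ : (x : Fin n) → x +ₙ 0ₙ ≡ x
  +ₙ-identityʳ x = begin
    (toℕ x + toℕ (0ₙ {n})) mod n  ≡⟨ cong (λ t → (toℕ x + t) mod n) toℕ-0ₙ ⟩
    (toℕ x + 0) mod n             ≡⟨ cong (_mod n) (+-identityʳ (toℕ x)) ⟩
    toℕ x mod n                   ≡⟨ mod-toℕ x ⟩
    x                             ∎

  +ₙ-identityˡ : (x : Fin n) → 0ₙ +ₙ x ≡ x
  +ₙ-identityˡ x = trans (+ₙ-comm 0ₙ x) (+ₙ-identityʳ x)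

  x-y+y≡x : (x y : Fin n) → (x -ₙ y) +ₙ y ≡ x
  x-y+y≡x x y = trans (%-cong-mod (begin
    (toℕ (x -ₙ y) + toℕ y) % n                  ≡⟨ cong (λ t → (t + toℕ y) % n) (toℕ-mod _) ⟩
    ((toℕ x + (n ∸ toℕ y)) % n + toℕ y) % n    ≡⟨ [[m+a]%n+b]%n≡m%n _ _ _ (m∸n+n≡m (<⇒≤ (toℕ<n y))) ⟩
    toℕ x % n                                   ∎))
    (mod-toℕ x)

  x+y-y≡x : (x y : Fin n) → (x +ₙ y) -ₙ y ≡ x
  x+y-y≡x x y = trans (%-cong-mod (begin
    (toℕ (x +ₙ y) + (n ∸ toℕ y)) % n            ≡⟨ cong (λ t → (t + (n ∸ toℕ y)) % n) (toℕ-mod _) ⟩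
    ((toℕ x + toℕ y) % n + (n ∸ toℕ y)) % n    ≡⟨ [[m+a]%n+b]%n≡m%n _ _ _ (m+[n∸m]≡n (<⇒≤ (toℕ<n y))) ⟩
    toℕ x % n                                   ∎))
    (mod-toℕ x)

  z+y≡x⇒x-y≡z : {x : Fin n} (y : Fin n) {z : Fin n} → z +ₙ y ≡ x → x -ₙ y ≡ z
  z+y≡x⇒x-y≡z y {z} eq = trans (cong (_-ₙ y) (sym eq)) (x+y-y≡x z y)

  x-x≡0 : (x : Fin n) → x -ₙ x ≡ 0ₙ
  x-x≡0 x = z+y≡x⇒x-y≡z x (+ₙ-identityˡ x)

  x-0≡x : (x : Fin n) → x -ₙ 0ₙ ≡ x
  x-0≡x x = z+y≡x⇒x-y≡z 0ₙ (+ₙ-identityʳ x)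

  x+y-x≡y : (x y : Fin n) → (x +ₙ y) -ₙ x ≡ y
  x+y-x≡y x y = z+y≡x⇒x-y≡z x (+ₙ-comm y x)

  x+[y-x]≡y : (x y : Fin n) → x +ₙ (y -ₙ x) ≡ y
  x+[y-x]≡y x y = trans (+ₙ-comm x _) (x-y+y≡x y x)

  [x-y]+[y-z]≡x-z : (x y z : Fin n) → (x -ₙ y) +ₙ (y -ₙ z) ≡ x -ₙ z
  [x-y]+[y-z]≡x-z x y z = sym (z+y≡x⇒x-y≡z z (begin
    (x -ₙ y) +ₙ (y -ₙ z) +ₙ z    ≡⟨ +ₙ-assoc _ _ z ⟩
    (x -ₙ y) +ₙ ((y -ₙ z) +ₙ z)  ≡⟨ cong ((x -ₙ y) +ₙ_) (x-y+y≡x y z) ⟩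
    (x -ₙ y) +ₙ y                ≡⟨ x-y+y≡x x y ⟩
    x                            ∎))

  0-[x-y]≡y-x : (x y : Fin n) → 0ₙ -ₙ (x -ₙ y) ≡ y -ₙ x
  0-[x-y]≡y-x x y = z+y≡x⇒x-y≡z (x -ₙ y) (trans ([x-y]+[y-z]≡x-z y x y) (x-x≡0 y))

  [x-z]-[y-z]≡x-y : (x y z : Fin n) → (x -ₙ z) -ₙ (y -ₙ z) ≡ x -ₙ y
  [x-z]-[y-z]≡x-y x y z = z+y≡x⇒x-y≡z (y -ₙ z) ([x-y]+[y-z]≡x-z x y z)

  [x-z]-[x-y]≡y-z : (x y z : Fin n) → (x -ₙ z) -ₙ (x -ₙ y) ≡ y -ₙ z
  [x-z]-[x-y]≡y-z x y z = z+y≡x⇒x-y≡z (x -ₙ y) (trans (+ₙ-comm (y -ₙ z) (x -ₙ y)) ([x-y]+[y-z]≡x-z x y z))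

  [x+a]-[y+a]≡x-y : (x y a : Fin n) → (x +ₙ a) -ₙ (y +ₙ a) ≡ x -ₙ y
  [x+a]-[y+a]≡x-y x y a = z+y≡x⇒x-y≡z (y +ₙ a) (begin
    (x -ₙ y) +ₙ (y +ₙ a)  ≡⟨ +ₙ-assoc _ y a ⟨
    (x -ₙ y) +ₙ y +ₙ a    ≡⟨ cong (_+ₙ a) (x-y+y≡x x y) ⟩
    x +ₙ a                ∎)

  x+a≡x⇒a≡0 : {x a : Fin n} → x +ₙ a ≡ x → a ≡ 0ₙ
  x+a≡x⇒a≡0 {x} {a} eq = begin
    a                ≡⟨ x+y-x≡y x a ⟨
    (x +ₙ a) -ₙ x    ≡⟨ cong (_-ₙ x) eq ⟩
    x -ₙ x           ≡⟨ x-x≡0 x ⟩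
    0ₙ               ∎

  x+a+[0-a]≡x : (x a : Fin n) → x +ₙ a +ₙ (0ₙ -ₙ a) ≡ x
  x+a+[0-a]≡x x a = begin
    x +ₙ a +ₙ (0ₙ -ₙ a)    ≡⟨ +ₙ-assoc x a _ ⟩
    x +ₙ (a +ₙ (0ₙ -ₙ a))  ≡⟨ cong (x +ₙ_) (x+[y-x]≡y a 0ₙ) ⟩
    x +ₙ 0ₙ                ≡⟨ +ₙ-identityʳ x ⟩
    x                      ∎

  x+[0-a]+a≡x : (x a : Fin n) → x +ₙ (0ₙ -ₙ a) +ₙ a ≡ x
  x+[0-a]+a≡x x a = begin
    x +ₙ (0ₙ -ₙ a) +ₙ a    ≡⟨ +ₙ-assoc x _ a ⟩
    x +ₙ ((0ₙ -ₙ a) +ₙ a)  ≡⟨ cong (x +ₙ_) (x-y+y≡x 0ₙ a) ⟩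
    x +ₙ 0ₙ                ≡⟨ +ₙ-identityʳ x ⟩
    x                      ∎

  [k%n]+[1%n]≡[1+k]%n : ∀ k → (k mod n) +ₙ (1 mod n) ≡ suc k mod n
  [k%n]+[1%n]≡[1+k]%n k = %-cong-mod (begin
    (toℕ (k mod n) + toℕ (1 mod n)) % n  ≡⟨ cong₂ (λ a b → (a + b) % n) (toℕ-mod k) (toℕ-mod 1) ⟩
    (k % n + 1 % n) % n                  ≡⟨ %-distribˡ-+ k 1 n ⟨
    (k + 1) % n                          ≡⟨ cong (_% n) (+-comm k 1) ⟩
    suc k % n                            ∎)

module _ {n : ℕ} where

  inverse⇒IsBij : {f h : Fun n} → (∀ x → h (f x) ≡ x) → (∀ y → f (h y) ≡ y) → IsBij f
  inverse⇒IsBij {f} {h} hf fh =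
    (λ x y eq → trans (sym (hf x)) (trans (cong h eq) (hf y))) , λ y → h y , fh y

  IsBij⇒inverse : {f : Fun n} → IsBij f → ∃ λ h → (∀ x → h (f x) ≡ x) × (∀ y → f (h y) ≡ y)
  IsBij⇒inverse (injective , surjective) =
    (λ y → proj₁ (surjective y)) , (λ x → injective _ x (proj₂ (surjective _))) , λ y → proj₂ (surjective y)

  IsBij-id : IsBij (idF {n})
  IsBij-id = inverse⇒IsBij {h = idF} (λ _ → refl) (λ _ → refl)

  IsBij-∘ : {f g : Fun n} → IsBij f → IsBij g → IsBij (λ x → f (g x))
  IsBij-∘ {f} {g} bf bg with IsBij⇒inverse bf | IsBij⇒inverse bg
  ... | hf , hf∘f , f∘hf | hg , hg∘g , g∘hg =
    inverse⇒IsBij {h = λ y → hg (hf y)}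
      (λ x → trans (cong hg (hf∘f (g x))) (hg∘g x))
      (λ y → trans (cong f (g∘hg (hf y))) (f∘hf y))

  IsBij-≗ : {f g : Fun n} → f ≗ g → IsBij f → IsBij g
  IsBij-≗ f≗g bf with IsBij⇒inverse bf
  ... | h , hf , fh = inverse⇒IsBij {h = h}
    (λ x → trans (cong h (sym (f≗g x))) (hf x)) (λ y → trans (sym (f≗g _)) (fh y))

  Preserves : (Fin n → Fin n → Set) → Fun n → Set
  Preserves P f = ∀ u v → P u v ⇔ P (f u) (f v)

  module _ {P : Fin n → Fin n → Set} where

    preserves-≗ : {f g : Fun n} → f ≗ g → Preserves P f → Preserves P g
    preserves-≗ f≗g pf u v = subst₂ (λ a b → P u v ⇔ P a b) (f≗g u) (f≗g v) (pf u v)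

    preserves-id : Preserves P idF
    preserves-id u v = ⇔-id _

    preserves-∘ : {f g : Fun n} → Preserves P f → Preserves P g → Preserves P (λ x → f (g x))
    preserves-∘ {g = g} pf pg u v = pf (g u) (g v) ⇔-∘ pg u v

    preserves-inverse : {f h : Fun n} → (∀ y → f (h y) ≡ y) → Preserves P f → Preserves P h
    preserves-inverse {f} {h} fh pf u v =
      ⇔-sym (subst₂ (λ a b → P (h u) (h v) ⇔ P a b) (fh u) (fh v) (pf (h u) (h v)))

    preserves-by-agreement : {f : Fun n} →
      (∀ x y → ∃ λ h → Preserves P h × h x ≡ f x × h y ≡ f y) → Preserves P f
    preserves-by-agreement agree u v with agree u v
    ... | h , ph , hu , hv = subst₂ (λ a b → P u v ⇔ P a b) hu hv (ph u v)

  ⊆-Closure2 : {G : Fun n → Set} → (∀ f → G f → IsBij f) → ∀ f → G f → Closure2 G f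
  ⊆-Closure2 G-bij f Gf = G-bij f Gf , λ _ _ → f , Gf , refl , refl

  Aut : {I : Set} → (I → Fin n → Fin n → Set) → Fun n → Set
  Aut Rel f = IsBij f × ∀ i → Preserves (Rel i) f

  module _ {I : Set} (Rel : I → Fin n → Fin n → Set) where

    Aut-isPermGroup : IsPermGroup (Aut Rel)
    Aut-isPermGroup =
        (λ f g f≗g (bf , pf) → IsBij-≗ f≗g bf , λ i → preserves-≗ f≗g (pf i))
      , (λ f → proj₁)
      , (IsBij-id , λ i → preserves-id)
      , (λ f g (bf , pf) (bg , pg) → IsBij-∘ bf bg , λ i → preserves-∘ (pf i) (pg i))
      , λ f (bf , pf) → let (h , hf , fh) = IsBij⇒inverse bf in
          h , (inverse⇒IsBij fh hf , λ i → preserves-inverse fh (pf i)) , hf , fh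

    Aut-2-closed : ∀ f → Closure2 (Aut Rel) f → Aut Rel f
    Aut-2-closed f (bf , agree) = bf , λ i → preserves-by-agreement λ x y →
      let (h , (_ , ph) , hx , hy) = agree x y in h , ph i , hx , hy

iter-+ : ∀ {n} (f : Fun n) a b x → iter f a (iter f b x) ≡ iter f (a + b) x
iter-+ f zero b x = refl
iter-+ f (suc a) b x = cong f (iter-+ f a b x)

IsCyclic⇒commute : ∀ {n} {R : Fun n → Set} → IsCyclic R →
  ∀ f g → R f → R g → ∀ x → f (g x) ≡ g (f x)
IsCyclic⇒commute (σ , _ , powers) f g Rf Rg x with powers f Rf | powers g Rg
... | a , f≗σᵃ | b , g≗σᵇ = begin
  f (g x)                ≡⟨ f≗σᵃ _ ⟩
  iter σ a (g x)         ≡⟨ cong (iter σ a) (g≗σᵇ x) ⟩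
  iter σ a (iter σ b x)  ≡⟨ iter-+ σ a b x ⟩
  iter σ (a + b) x       ≡⟨ cong (λ t → iter σ t x) (+-comm a b) ⟩
  iter σ (b + a) x       ≡⟨ iter-+ σ b a x ⟨
  iter σ b (iter σ a x)  ≡⟨ cong (iter σ b) (f≗σᵃ x) ⟨
  iter σ b (f x)         ≡⟨ g≗σᵇ _ ⟨
  g (f x)                ∎
  where open ≡-Reasoning

module _ {n : ℕ} .{{_ : NonZero n}} where

  Circulant : (Fin n → Set) → Fin n → Fin n → Set
  Circulant D u v = D (u -ₙ v)

  Circulant-0ₙ : (D : Fin n → Set) (x : Fin n) → Circulant D x 0ₙ ⇔ D x
  Circulant-0ₙ D x = mk⇔ (subst D (x-0≡x x)) (subst D (sym (x-0≡x x)))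

  SameCoset : Subset n → Fin n → Fin n → Set
  SameCoset L = Circulant (_∈ L)

  module _ {L : Subset n} (L-sub : IsSubgroupℤ L) where

    SameCoset-refl : ∀ x → SameCoset L x x
    SameCoset-refl x = subst (_∈ L) (sym (x-x≡0 x)) (proj₁ L-sub)

    SameCoset-sym : ∀ x y → SameCoset L x y → SameCoset L y x
    SameCoset-sym x y x~y = subst (_∈ L) (0-[x-y]≡y-x x y) (proj₂ L-sub _ _ (proj₁ L-sub) x~y)

    SameCoset-trans : ∀ x y z → SameCoset L x y → SameCoset L y z → SameCoset L x z
    SameCoset-trans x y z x~y y~z =
      subst (_∈ L) ([x-z]-[y-z]≡x-y x z y) (proj₂ L-sub _ _ x~y (SameCoset-sym y z y~z))

  UnionOfCosetsOutside : (Fin n → Set) → Subset n → Subset n → Set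
  UnionOfCosetsOutside D K H = ∀ d e → SameCoset K e d → d ∉ H → D d → D e

  GenWreath⇒UnionOfCosetsOutside : {S K H : Subset n} →
    GenWreath S K H → UnionOfCosetsOutside (_∈ S) K H
  GenWreath⇒UnionOfCosetsOutside {S} gw d e e~d d∉H d∈S =
    subst (_∈ S) (x+[y-x]≡y d e) (gw d (e -ₙ d) d∈S d∉H e~d)

  subgroup⇒UnionOfCosetsOutside : {K L H : Subset n} →
    IsSubgroupℤ L → K ⊆ L → UnionOfCosetsOutside (_∈ L) K H
  subgroup⇒UnionOfCosetsOutside {L = L} L-sub K⊆L d e e~d _ d∈L =
    to (Circulant-0ₙ (_∈ L) e)
      (SameCoset-trans L-sub e d 0ₙ (K⊆L e~d) (from (Circulant-0ₙ (_∈ L) d) d∈L))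

  UnionOfCosetsOutside-⇔ : {D : Fin n → Set} {K H : Subset n} →
    IsSubgroupℤ K → IsSubgroupℤ H → K ⊆ H → UnionOfCosetsOutside D K H →
    ∀ d e → SameCoset K e d → d ∉ H → D d ⇔ D e
  UnionOfCosetsOutside-⇔ {K = K} {H} K-sub H-sub K⊆H union d e e~d d∉H =
    mk⇔ (union d e e~d d∉H) (union e d (SameCoset-sym K-sub e d e~d) e∉H)
    where
    e∉H : e ∉ H
    e∉H e∈H = d∉H (to (Circulant-0ₙ (_∈ H) d)
      (SameCoset-trans H-sub d e 0ₙ (SameCoset-sym H-sub e d (K⊆H e~d)) (from (Circulant-0ₙ (_∈ H) e) e∈H)))

  translate : Fin n → Fun n
  translate a x = x +ₙ a

  IsTranslation : Fun n → Set
  IsTranslation f = ∃ λ a → f ≗ translate a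

  translate-isBij : ∀ a → IsBij (translate a)
  translate-isBij a = inverse⇒IsBij {h = λ y → y -ₙ a} (λ x → x+y-y≡x x a) (λ y → x-y+y≡x y a)

  translate-preserves : ∀ D a → Preserves (Circulant D) (translate a)
  translate-preserves D a u v = subst (λ d → D (u -ₙ v) ⇔ D d) (sym ([x+a]-[y+a]≡x-y u v a)) (⇔-id _)

  IsTranslation⇒Aut : {I : Set} (D : I → Fin n → Set) → ∀ f → IsTranslation f →
    Aut (λ i → Circulant (D i)) f
  IsTranslation⇒Aut D f (a , f≗τ) =
    IsBij-≗ τ≗f (translate-isBij a) , λ i → preserves-≗ τ≗f (translate-preserves (D i) a)
    where
    τ≗f : translate a ≗ f
    τ≗f x = sym (f≗τ x)

  IsTranslation-isPermGroup : IsPermGroup IsTranslation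
  IsTranslation-isPermGroup =
      (λ f g f≗g (a , f≗τ) → a , λ x → trans (sym (f≗g x)) (f≗τ x))
    , (λ f (a , f≗τ) → IsBij-≗ (λ x → sym (f≗τ x)) (translate-isBij a))
    , (0ₙ , λ x → sym (+ₙ-identityʳ x))
    , (λ f g (a , f≗τ) (b , g≗τ) → b +ₙ a , λ x →
        trans (f≗τ _) (trans (cong (_+ₙ a) (g≗τ x)) (+ₙ-assoc x b a)))
    , λ f (a , f≗τ) → translate (0ₙ -ₙ a) , (0ₙ -ₙ a , λ _ → refl)
        , (λ x → trans (cong (_+ₙ (0ₙ -ₙ a)) (f≗τ x)) (x+a+[0-a]≡x x a))
        , (λ x → trans (f≗τ _) (x+[0-a]+a≡x x a))

  iter-translate-1 : ∀ k x → iter (translate (1 mod n)) k x ≡ x +ₙ (k mod n)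
  iter-translate-1 zero x = sym (+ₙ-identityʳ x)
  iter-translate-1 (suc k) x = begin
    iter (translate (1 mod n)) k x +ₙ (1 mod n)  ≡⟨ cong (_+ₙ (1 mod n)) (iter-translate-1 k x) ⟩
    x +ₙ (k mod n) +ₙ (1 mod n)                  ≡⟨ +ₙ-assoc x _ _ ⟩
    x +ₙ ((k mod n) +ₙ (1 mod n))                ≡⟨ cong (x +ₙ_) ([k%n]+[1%n]≡[1+k]%n k) ⟩
    x +ₙ (suc k mod n)                           ∎
    where open ≡-Reasoning

  IsTranslation-isCyclic : IsCyclic IsTranslation
  IsTranslation-isCyclic = translate (1 mod n) , (1 mod n , λ _ → refl) , λ f (a , f≗τ) →
    toℕ a , λ x → trans (f≗τ x) (trans (cong (x +ₙ_) (sym (mod-toℕ a))) (sym (iter-translate-1 (toℕ a) x)))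

  IsTranslation-isRegular : IsRegular IsTranslation
  IsTranslation-isRegular =
      (λ x y → translate (y -ₙ x) , (y -ₙ x , λ _ → refl) , x+[y-x]≡y x y)
    , λ f x (a , f≗τ) fx≡x z →
        trans (f≗τ z) (trans (cong (z +ₙ_) (x+a≡x⇒a≡0 (trans (sym (f≗τ x)) fx≡x))) (+ₙ-identityʳ z))

  restrict-inside : ∀ H c (g : Fun n) x → SameCoset H x c → restrict H c g x ≡ g x
  restrict-inside H c g x x∈C with (x -ₙ c) ∈? H
  ... | yes _ = refl
  ... | no x∉C = ⊥-elim (x∉C x∈C)

  restrict-outside : ∀ H c (g : Fun n) x → ¬ SameCoset H x c → restrict H c g x ≡ x
  restrict-outside H c g x x∉C with (x -ₙ c) ∈? H
  ... | yes x∈C = ⊥-elim (x∉C x∈C)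
  ... | no _ = refl

  module Restriction {K H : Subset n} (K-sub : IsSubgroupℤ K) (H-sub : IsSubgroupℤ H) (K⊆H : K ⊆ H)
                     (c : Fin n) {g : Fun n} (g-fixes : ∀ x → SameCoset K (g x) x) where

    g′ : Fun n
    g′ = restrict H c g

    InC : Fin n → Set
    InC x = SameCoset H x c

    data View (x : Fin n) : Set where
      inside  : InC x → g′ x ≡ g x → View x
      outside : ¬ InC x → g′ x ≡ x → View x

    view : ∀ x → View x
    view x with (x -ₙ c) ∈? H
    ... | yes x∈C = inside x∈C (restrict-inside H c g x x∈C)
    ... | no x∉C = outside x∉C (restrict-outside H c g x x∉C)

    g-stable : ∀ x → InC x ⇔ InC (g x)
    g-stable x = mk⇔ (SameCoset-trans H-sub (g x) x c (K⊆H (g-fixes x)))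
                     (SameCoset-trans H-sub x (g x) c (SameCoset-sym H-sub (g x) x (K⊆H (g-fixes x))))

    restrict-isBij : IsBij g → IsBij g′
    restrict-isBij (g-inj , g-surj) = injective , surjective
      where
      injective : ∀ x y → g′ x ≡ g′ y → x ≡ y
      injective x y eq with view x | view y
      ... | inside _ ex   | inside _ ey   = g-inj x y (trans (sym ex) (trans eq ey))
      ... | outside _ ex  | outside _ ey  = trans (sym ex) (trans eq ey)
      ... | inside x∈C ex | outside y∉C ey =
        ⊥-elim (y∉C (subst InC (trans (sym ex) (trans eq ey)) (to (g-stable x) x∈C)))
      ... | outside x∉C ex | inside y∈C ey =
        ⊥-elim (x∉C (subst InC (trans (sym ey) (trans (sym eq) ex)) (to (g-stable y) y∈C)))

      surjective : ∀ y → ∃ λ x → g′ x ≡ y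
      surjective y with view y | g-surj y
      ... | outside _ ey | _ = y , ey
      ... | inside y∈C _ | x , gx≡y with view x
      ...   | inside _ ex = x , trans ex gx≡y
      ...   | outside x∉C _ = ⊥-elim (x∉C (from (g-stable x) (subst InC (sym gx≡y) y∈C)))

    along : {D : Fin n → Set} {u v a b : Fin n} → g′ u ≡ a → g′ v ≡ b →
      Circulant D u v ⇔ Circulant D a b → Circulant D u v ⇔ Circulant D (g′ u) (g′ v)
    along {D} {u} {v} eu ev = subst₂ (λ a b → Circulant D u v ⇔ Circulant D a b) (sym eu) (sym ev)

    restrict-preserves : {D : Fin n → Set} → UnionOfCosetsOutside D K H →
      Preserves (Circulant D) g → Preserves (Circulant D) g′
    restrict-preserves {D} union pg u v with view u | view v
    ... | inside _ eu  | inside _ ev  = along {D} eu ev (pg u v)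
    ... | outside _ eu | outside _ ev = along {D} eu ev (⇔-id _)
    ... | inside u∈C eu | outside v∉C ev = along {D} eu ev (UnionOfCosetsOutside-⇔ K-sub H-sub K⊆H union
          (u -ₙ v) (g u -ₙ v)
          (subst (_∈ K) (sym ([x-z]-[y-z]≡x-y (g u) u v)) (g-fixes u))
          (λ u~v → v∉C (SameCoset-trans H-sub v u c (SameCoset-sym H-sub u v u~v) u∈C)))
    ... | outside u∉C eu | inside v∈C ev = along {D} eu ev (UnionOfCosetsOutside-⇔ K-sub H-sub K⊆H union
          (u -ₙ v) (u -ₙ g v)
          (subst (_∈ K) (sym ([x-z]-[x-y]≡y-z u v (g v))) (SameCoset-sym K-sub (g v) v (g-fixes v)))
          (λ u~v → u∉C (SameCoset-trans H-sub u v c u~v v∈C)))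

    restrict-Aut : {I : Set} {D : I → Fin n → Set} → (∀ i → UnionOfCosetsOutside (D i) K H) →
      Aut (λ i → Circulant (D i)) g → Aut (λ i → Circulant (D i)) g′
    restrict-Aut union (bg , pg) = restrict-isBij bg , λ i → restrict-preserves (union i) (pg i)

  HasWreathGroup : (S K H : Subset n) → Set₁
  HasWreathGroup S K H = Σ (Fun n → Set) λ G →
    IsPermGroup G
    × (∀ f → G f → IsAut S f)
    × HasRegularCyclicSubgroup G
    × IsBlockSystemCosets G K
    × IsBlockSystemCosets G H
    × (∀ (c : Fin n) f → Fix (Closure2 G) K f → Closure2 G (restrict H c f))

  data WreathInvariant : Set where
    arcs K-cosets H-cosets : WreathInvariant

  wreathInvariant : (S K H : Subset n) → WreathInvariant → Fin n → Set
  wreathInvariant S K H arcs      = _∈ S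
  wreathInvariant S K H K-cosets  = _∈ K
  wreathInvariant S K H H-cosets  = _∈ H

  GenWreath⇒HasWreathGroup : {S K H : Subset n} → IsSubgroupℤ K → IsSubgroupℤ H → K ⊆ H →
    GenWreath S K H → HasWreathGroup S K H
  GenWreath⇒HasWreathGroup {S} {K} {H} K-sub H-sub K⊆H gw =
      Aut Rel
    , Aut-isPermGroup Rel
    , (λ f (bf , pf) → bf , pf arcs)
    , (IsTranslation , IsTranslation-isPermGroup , IsTranslation⇒Aut (wreathInvariant S K H)
      , IsTranslation-isCyclic , IsTranslation-isRegular)
    , (λ f (_ , pf) x y → to (pf K-cosets x y))
    , (λ f (_ , pf) x y → to (pf H-cosets x y))
    , λ c f (f∈G⁽²⁾ , f-fixes) → ⊆-Closure2 (λ _ → proj₁) _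
        (Restriction.restrict-Aut K-sub H-sub K⊆H c f-fixes union (Aut-2-closed Rel f f∈G⁽²⁾))
    where
    Rel : WreathInvariant → Fin n → Fin n → Set
    Rel i = Circulant (wreathInvariant S K H i)
    union : ∀ i → UnionOfCosetsOutside (wreathInvariant S K H i) K H
    union arcs     = GenWreath⇒UnionOfCosetsOutside gw
    union K-cosets = subgroup⇒UnionOfCosetsOutside K-sub (λ k∈K → k∈K)
    union H-cosets = subgroup⇒UnionOfCosetsOutside H-sub K⊆H

  module _ {G R : Fun n → Set} {K : Subset n} (R⊆G : ∀ f → R f → G f)
           (R-commutes : ∀ f g → R f → R g → ∀ x → f (g x) ≡ g (f x))
           (R-transitive : ∀ x y → ∃ λ f → R f × f x ≡ y)
           (K-blocks : IsBlockSystemCosets G K) where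

    shift-fixing-K-cosets : ∀ x y → SameCoset K y x →
      ∃ λ r → R r × r x ≡ y × (∀ z → SameCoset K (r z) z)
    shift-fixing-K-cosets x y y~x with R-transitive x y
    ... | r , Rr , rx≡y = r , Rr , rx≡y , fixes
      where
      fixes : ∀ z → SameCoset K (r z) z
      fixes z with R-transitive x z
      ... | r′ , Rr′ , r′x≡z = subst₂ (SameCoset K) r′y≡rz r′x≡z
        (K-blocks r′ (R⊆G r′ Rr′) y x y~x)
        where
        open ≡-Reasoning
        r′y≡rz : r′ y ≡ r z
        r′y≡rz = begin
          r′ y        ≡⟨ cong r′ rx≡y ⟨
          r′ (r x)    ≡⟨ R-commutes r′ r Rr′ Rr x ⟩
          r (r′ x)    ≡⟨ cong r r′x≡z ⟩
          r z         ∎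

  HasWreathGroup⇒GenWreath : {S K H : Subset n} → IsSubgroupℤ H →
    HasWreathGroup S K H → GenWreath S K H
  HasWreathGroup⇒GenWreath {S} {K} {H} H-sub
    (G , G-perm , G-aut , (R , _ , R⊆G , R-cyclic , R-transitive , _) , K-blocks , _ , restriction)
    s k s∈S s∉H k∈K
    with shift-fixing-K-cosets R⊆G (IsCyclic⇒commute R-cyclic) R-transitive K-blocks
           s (s +ₙ k) (subst (_∈ K) (sym (x+y-x≡y s k)) k∈K)
  ... | r , Rr , rs≡s+k , r-fixes with proj₂ r|C∈G⁽²⁾ s 0ₙ
    where
    r|C∈G⁽²⁾ : Closure2 G (restrict H s r)
    r|C∈G⁽²⁾ = restriction s r (⊆-Closure2 (proj₁ (proj₂ G-perm)) r (R⊆G r Rr) , r-fixes)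
  ... | h , Gh , hs , h0 =
    to (Circulant-0ₙ (_∈ S) (s +ₙ k))
      (subst₂ (Arc S) hs≡s+k h0≡0 (to (proj₂ (G-aut h Gh) s 0ₙ) (from (Circulant-0ₙ (_∈ S) s) s∈S)))
    where
    hs≡s+k : h s ≡ s +ₙ k
    hs≡s+k = trans hs (trans (restrict-inside H s r s (SameCoset-refl H-sub s)) rs≡s+k)
    h0≡0 : h 0ₙ ≡ 0ₙ
    h0≡0 = trans h0 (restrict-outside H s r 0ₙ λ 0~s →
      s∉H (to (Circulant-0ₙ (_∈ H) s) (SameCoset-sym H-sub 0ₙ s 0~s)))

lemma2p10 : (n : ℕ) .{{_ : NonZero n}} (S K H : Subset n)
    → 0ₙ ∉ S
    → IsSubgroupℤ K → IsSubgroupℤ H → K ⊆ H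
    → (∃ λ k → k ∈ K × k ≢ 0ₙ)
    → (∃ λ x → x ∉ H)
    → GenWreath S K H
      ⇔ (Σ (Fun n → Set) λ G →
           IsPermGroup G
           × (∀ f → G f → IsAut S f)
           × HasRegularCyclicSubgroup G
           × IsBlockSystemCosets G K
           × IsBlockSystemCosets G H
           × (∀ (c : Fin n) f → Fix (Closure2 G) K f → Closure2 G (restrict H c f)))
lemma2p10 n S K H _ K-sub H-sub K⊆H _ _ =
  mk⇔ (GenWreath⇒HasWreathGroup K-sub H-sub K⊆H) (HasWreathGroup⇒GenWreath H-sub)
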